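{- (No Risk Lemma) Let $\mathcal E$ be a monotone increasing event over independent binary random variables. Then $\mathcal E$ itself testifies risk $\Pr(\mathcal E)$ for $\mathcal E$; in particular the risk of $\mathcal E$ is at most $\Pr(\mathcal E)$.
   Context: Variables have range $\{\text{black},\text{white}\}$. A partial assignment gives each variable a value or $\bot$ (unset); $\psi$ is a retraction of $\varphi$ if $\psi(x)=\varphi(x)$ whenever $\psi(x)\ne\bot$. $\Pr(\mathcal E\mid\psi)$ is the probability of $\mathcal E$ with set variables fixed as in $\psi$ and unset ones random. An event $\mathcal E$ is monotone increasing (black-favoring) if $\Pr(\mathcal E\mid\psi)\le\Pr(\mathcal E\mid\varphi)$ for all partial assignments $\psi,\varphi$ with $\psi(x)\le\varphi(x)$ for every $x\in\mathrm{vbl}(\mathcal E)$, in the order black $<\bot<$ white. For an event $\mathcal E'$, $\mathrm{Respect}(\mathcal E')$ is the set of partial assignments $\psi$ that are a retraction of some full assignment $\varphi$ avoiding $\mathcal E'$ and such that either all variables of $\mathrm{vbl}(\mathcal E')$ white under $\varphi$ are unset in $\psi$, or no variable of $\mathrm{vbl}(\mathcal E')$ black under $\varphi$ is unset in $\psi$. An event $\mathcal E'\supseteq\mathcal E$ testifies risk $x$ for $\mathcal E$ if $\max\{\Pr(\mathcal E'),\max_{\psi\in\mathrm{Respect}(\mathcal E')}\Pr(\mathcal E\mid\psi)\}\le x$; the risk of $\mathcal E$ is the least $x$ testified by some $\mathcal E'\supseteq\mathcal E$.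
   Formalization: The probability with which each independent binary variable is black is a rational number in [0,1]. -}

module Defs where

open import Data.Nat using (ℕ; zero; suc)
import Data.Nat as ℕ
open import Data.Fin using (Fin; zero; suc)
open import Data.Fin.Subset using (Subset; _∈_)
open import Data.Bool using (Bool; true; false)
open import Data.Maybe using (Maybe; just; nothing)
open import Data.Product using (Σ; _×_; ∃; proj₁)
open import Data.Sum using (_⊎_)
open import Data.Rational using (ℚ; 0ℚ; 1ℚ; _+_; _*_; _-_; _≤_)
open import Relation.Binary.PropositionalEquality using (_≡_; _≢_)

data Color : Set where
  black white : Color

Assignment : ℕ → Set
Assignment n = Fin n → Color

-- Partial assignments: nothing = ⊥ (unset).
PartialAssignment : ℕ → Set
PartialAssignment n = Fin n → Maybe Color

unsetAll : ∀ {n} → PartialAssignment n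
unsetAll _ = nothing

-- Product distribution: p x ∈ [0,1] is the probability that variable x is black.
Distribution : ℕ → Set
Distribution n = Σ (Fin n → ℚ) λ p → ∀ x → (0ℚ ≤ p x) × (p x ≤ 1ℚ)

private
  indicator : Bool → ℚ
  indicator true  = 1ℚ
  indicator false = 0ℚ

  extend : ∀ {n} → Color → Assignment n → Assignment (suc n)
  extend c σ zero    = c
  extend c σ (suc x) = σ x

-- Pr(E | ψ) for a predicate E on full assignments: variables set in ψ are
-- fixed, unset variables are independent with Pr(x = black) = p x.
condProbFun : ∀ n → (Fin n → ℚ) → PartialAssignment n → (Assignment n → Bool) → ℚ
condProbFun zero    p ψ E = indicator (E (λ ()))
condProbFun (suc n) p ψ E with ψ zero
... | just c  = condProbFun n (λ x → p (suc x)) (λ x → ψ (suc x)) (λ σ → E (extend c σ))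
... | nothing =
  p zero * condProbFun n (λ x → p (suc x)) (λ x → ψ (suc x)) (λ σ → E (extend black σ))
  + (1ℚ - p zero) * condProbFun n (λ x → p (suc x)) (λ x → ψ (suc x)) (λ σ → E (extend white σ))

record Event (n : ℕ) : Set where
  field
    vbl     : Subset n
    holds   : Assignment n → Bool
    determined : ∀ σ τ → (∀ x → x ∈ vbl → σ x ≡ τ x) → holds σ ≡ holds τ
open Event public

PrGiven : ∀ {n} → Distribution n → Event n → PartialAssignment n → ℚ
PrGiven {n} D E ψ = condProbFun n (proj₁ D) ψ (holds E)

Pr : ∀ {n} → Distribution n → Event n → ℚ
Pr D E = PrGiven D E unsetAll

rank : Maybe Color → ℕ
rank (just black) = 0
rank nothing      = 1
rank (just white) = 2

_≼_ : Maybe Color → Maybe Color → Set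
a ≼ b = rank a ℕ.≤ rank b

MonotoneIncreasing : ∀ {n} → Distribution n → Event n → Set
MonotoneIncreasing {n} D E =
  ∀ (ψ φ : PartialAssignment n) → (∀ x → x ∈ vbl E → ψ x ≼ φ x) →
  PrGiven D E ψ ≤ PrGiven D E φ

RetractionOf : ∀ {n} → PartialAssignment n → Assignment n → Set
RetractionOf ψ φ = ∀ x → (ψ x ≡ nothing) ⊎ (ψ x ≡ just (φ x))

Respect : ∀ {n} → Event n → PartialAssignment n → Set
Respect {n} E' ψ = ∃ λ (φ : Assignment n) →
  (holds E' φ ≡ false) × RetractionOf ψ φ ×
  ( (∀ x → x ∈ vbl E' → φ x ≡ white → ψ x ≡ nothing)
  ⊎ (∀ x → x ∈ vbl E' → φ x ≡ black → ψ x ≢ nothing))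

_⊆ᴱ_ : ∀ {n} → Event n → Event n → Set
E ⊆ᴱ E' = ∀ σ → holds E σ ≡ true → holds E' σ ≡ true

Testifies : ∀ {n} → Distribution n → Event n → Event n → ℚ → Set
Testifies {n} D E' E r =
  (E ⊆ᴱ E') × (Pr D E' ≤ r) ×
  (∀ (ψ : PartialAssignment n) → Respect E' ψ → PrGiven D E ψ ≤ r)

-- risk(E) ≤ r : some E' ⊇ E testifies a risk r' ≤ r (the least testified
-- value exists since the max is attained; "risk ≤ r" is this).
RiskAtMost : ∀ {n} → Distribution n → Event n → ℚ → Set
RiskAtMost {n} D E r = ∃ λ (E' : Event n) → ∃ λ r' → Testifies D E' E r' × (r' ≤ r)

{-# OPTIONS --safe #-}
module Submission where

-- A partial assignment respecting E either fixes only black values on vbl(E), and so lies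
-- below the all-unset assignment, whence Pr(E | ψ) ≤ Pr(E) by monotonicity; or it leaves
-- no black variable of vbl(E) unset, and so lies below a full assignment φ avoiding E,
-- whence Pr(E | ψ) ≤ Pr(E | φ) = 0 ≤ Pr(E).

open import Defs
open import Data.Nat using (ℕ; zero; suc; s≤s; z≤n)
import Data.Nat.Properties as ℕ
open import Data.Product using (_×_; _,_; proj₁; proj₂)
open import Data.Sum using (_⊎_; inj₁; inj₂)
open import Data.Fin using (Fin; zero; suc)
open import Data.Bool using (Bool; true; false)
open import Data.Maybe using (just; nothing)
open import Data.Rational using (ℚ; 0ℚ; 1ℚ; _+_; _*_; _-_; _≤_; -_; NonNegative; nonNegative)
open import Data.Rational.Properties
open import Function using (_∘_)
open import Relation.Nullary using (contradiction)
open import Relation.Binary.PropositionalEquality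

IsProbability : ℚ → Set
IsProbability p = (0ℚ ≤ p) × (p ≤ 1ℚ)

complement-nonNeg : ∀ {p} → p ≤ 1ℚ → 0ℚ ≤ 1ℚ - p
complement-nonNeg {p} p≤1 = subst (_≤ 1ℚ - p) (+-inverseʳ p) (+-monoˡ-≤ (- p) p≤1)

convexCombination-nonNeg : ∀ {p a b} → IsProbability p → 0ℚ ≤ a → 0ℚ ≤ b →
  0ℚ ≤ p * a + (1ℚ - p) * b
convexCombination-nonNeg {p} {a} {b} (0≤p , p≤1) 0≤a 0≤b =
  nonNegative⁻¹ (p * a + (1ℚ - p) * b)
    {{nonNeg+nonNeg⇒nonNeg (p * a) {{nonNeg*nonNeg⇒nonNeg p a}} ((1ℚ - p) * b) {{nonNeg*nonNeg⇒nonNeg (1ℚ - p) b}}}}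
  where
  instance
    p≥0 : NonNegative p
    p≥0 = nonNegative 0≤p
    1-p≥0 : NonNegative (1ℚ - p)
    1-p≥0 = nonNegative (complement-nonNeg p≤1)
    a≥0 : NonNegative a
    a≥0 = nonNegative 0≤a
    b≥0 : NonNegative b
    b≥0 = nonNegative 0≤b

-- Phrased via condProbFun zero because the indicator function of Defs is private.
indicator-nonNeg : ∀ p ψ b → 0ℚ ≤ condProbFun zero p ψ (λ _ → b)
indicator-nonNeg p ψ true  = nonNegative⁻¹ 1ℚ
indicator-nonNeg p ψ false = ≤-refl

condProbFun-nonNeg : ∀ n (p : Fin n → ℚ) → (∀ x → IsProbability (p x)) →
  ∀ ψ E → 0ℚ ≤ condProbFun n p ψ E
condProbFun-nonNeg zero    p p-prob ψ E = indicator-nonNeg p ψ (E _)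
condProbFun-nonNeg (suc n) p p-prob ψ E with ψ zero
... | just c  = condProbFun-nonNeg n (p ∘ suc) (p-prob ∘ suc) (ψ ∘ suc) _
... | nothing = convexCombination-nonNeg (p-prob zero)
  (condProbFun-nonNeg n (p ∘ suc) (p-prob ∘ suc) (ψ ∘ suc) _)
  (condProbFun-nonNeg n (p ∘ suc) (p-prob ∘ suc) (ψ ∘ suc) _)

condProbFun-fixed-outside : ∀ n (p : Fin n → ℚ) (φ : Assignment n) (E : Assignment n → Bool) →
  (∀ σ → σ ≗ φ → E σ ≡ false) → condProbFun n p (just ∘ φ) E ≡ 0ℚ
condProbFun-fixed-outside zero    p φ E outside =
  cong (λ b → condProbFun zero p (just ∘ φ) (λ _ → b)) (outside _ (λ ()))
condProbFun-fixed-outside (suc n) p φ E outside =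
  condProbFun-fixed-outside n (p ∘ suc) (φ ∘ suc) _
    (λ σ σ≗φ → outside _ λ { zero → refl ; (suc x) → σ≗φ x })

retraction-≼-unset : ∀ {a c} → a ≡ nothing ⊎ a ≡ just c → (c ≡ white → a ≡ nothing) → a ≼ nothing
retraction-≼-unset             (inj₁ refl) _          = ℕ.≤-refl
retraction-≼-unset {c = black} (inj₂ refl) _          = z≤n
retraction-≼-unset {c = white} (inj₂ refl) whiteUnset with () ← whiteUnset refl

retraction-≼-fixed : ∀ {a c} → a ≡ nothing ⊎ a ≡ just c → (c ≡ black → a ≢ nothing) → a ≼ just c
retraction-≼-fixed             (inj₂ refl) _        = ℕ.≤-refl
retraction-≼-fixed {c = black} (inj₁ refl) blackSet = contradiction refl (blackSet refl)
retraction-≼-fixed {c = white} (inj₁ refl) _        = s≤s z≤n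

module _ {n} (D : Distribution n) (E : Event n) where

  PrGiven-nonNeg : ∀ ψ → 0ℚ ≤ PrGiven D E ψ
  PrGiven-nonNeg ψ = condProbFun-nonNeg n (proj₁ D) (proj₂ D) ψ (holds E)

  PrGiven-fixed-outside : ∀ φ → holds E φ ≡ false → PrGiven D E (just ∘ φ) ≡ 0ℚ
  PrGiven-fixed-outside φ φ∉E = condProbFun-fixed-outside n (proj₁ D) φ (holds E)
    (λ σ σ≗φ → trans (determined E σ φ (λ x _ → σ≗φ x)) φ∉E)

  respected-PrGiven≤Pr : MonotoneIncreasing D E → ∀ ψ → Respect E ψ → PrGiven D E ψ ≤ Pr D E
  respected-PrGiven≤Pr mono ψ (φ , φ∉E , retract , inj₁ whitesUnset) =
    mono ψ unsetAll (λ x x∈vbl → retraction-≼-unset (retract x) (whitesUnset x x∈vbl))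
  respected-PrGiven≤Pr mono ψ (φ , φ∉E , retract , inj₂ blacksSet) = begin
    PrGiven D E ψ          ≤⟨ mono ψ (just ∘ φ) (λ x x∈vbl → retraction-≼-fixed (retract x) (blacksSet x x∈vbl)) ⟩
    PrGiven D E (just ∘ φ) ≡⟨ PrGiven-fixed-outside φ φ∉E ⟩
    0ℚ                     ≤⟨ PrGiven-nonNeg unsetAll ⟩
    Pr D E                 ∎
    where open ≤-Reasoning

lemmaL : ∀ (n : ℕ) (D : Distribution n) (E : Event n) →
    MonotoneIncreasing D E →
    Testifies D E E (Pr D E) × RiskAtMost D E (Pr D E)
lemmaL n D E mono = testifies , (E , Pr D E , testifies , ≤-refl)
  where
  testifies : Testifies D E E (Pr D E)
  testifies = (λ _ σ∈E → σ∈E) , ≤-refl , respected-PrGiven≤Pr D E mono
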